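{- Let $\mathcal M=(Q,s_{in},s_T,s_F,\delta)$ be a deterministic binary Turing machine with input. There is a term $\mathtt{final}$ of $\Lambda_{\tt det}$ such that for every term $k$ and every final configuration $C$ of $\mathcal M$ with state $s\in\{s_T,s_F\}$, $$\mathtt{final}\, k\, \lceil C\rceil \rightarrow_{det}^{\Theta(|Q|)} \begin{cases} k(\lambda x.\lambda y.x) & \text{if } s=s_T,\\ k(\lambda x.\lambda y.y) & \text{if } s=s_F.\end{cases}$$
   Context: $\Lambda_{\tt det}$: terms $t ::= v \mid t\,v$, values $v ::= \lambda x.t \mid x$; evaluation contexts $E ::= [\cdot] \mid E\,v$; reduction $E[(\lambda x.t)u] \rightarrow_{det} E[t\{x:=u\}]$. Encodings: for a finite ordered alphabet $\Sigma=\{a_1,\dots,a_m\}$, $\lceil a_j\rceil := \lambda x_1.\ldots\lambda x_m.x_j$; strings are Scott-encoded: $\lceil\varepsilon\rceil:=\lambda x_1.\ldots\lambda x_m.\lambda x_\varepsilon.x_\varepsilon$, $\lceil a_j r\rceil := \lambda x_1.\ldots\lambda x_m.\lambda x_\varepsilon.x_j\lceil r\rceil$. Alphabets: $\mathbb{B}_I=\{0,1,\mathsf{L},\mathsf{R}\}$, $\mathbb{B}_W=\{0,1,\Box\}$, and the finite ordered state set $Q$. $\mathrm{bin}(n)$ is the reversed binary representation of $n$ without trailing zeros, Scott-encoded over $\{0,1\}$. A configuration $(i, n \mid w_l, a, w_r \mid s)$ ($i\in\mathbb{B}_I^*$, $n\in\mathbb{N}$, $w_l,w_r\in\mathbb{B}_W^*$,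 $a\in\mathbb{B}_W$, $s\in Q$) is encoded as $\lambda x.\,x\,\lceil i\rceil\,\lceil \mathrm{bin}(n)\rceil\,\lceil w_l^{R}\rceil\,\lceil a\rceil\,\lceil w_r\rceil\,\lceil s\rceil$, with $w_l^R$ the reversal of $w_l$. A configuration is final if its state is $s_T$ or $s_F$. A deterministic binary Turing machine with input is $(Q,s_{in},s_T,s_F,\delta)$ with partial transition function $\delta:\mathbb{B}_I\times\mathbb{B}_W\times Q\rightharpoonup\{ -1,+1,0\}\times\mathbb{B}_W\times\{\leftarrow,\rightarrow,\downarrow\}\times Q$ defined only on non-final states. -}

module Defs where

open import Data.Nat using (ℕ; zero; suc; _+_; _*_; _∸_; _<ᵇ_; _≡ᵇ_; _≤_; pred)
open import Data.Nat.DivMod using (_/_; _%_; m%n<n)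
open import Data.Bool using (if_then_else_)
open import Data.Fin using (Fin; toℕ; fromℕ<)
open import Data.List using (List; []; _∷_; reverse)
open import Data.Maybe using (Maybe; nothing)
open import Data.Product using (_×_; Σ; ∃)
open import Relation.Binary.PropositionalEquality using (_≡_; _≢_)


-- Λ_det syntax (de Bruijn indices; `var 0` is the innermost binder)
--   terms  t ::= v | t v        values v ::= λ.t | x

mutual
  data Val : Set where
    var : ℕ → Val
    lam : Tm → Val

  data Tm : Set where
    val : Val → Tm
    app : Tm → Val → Tm

mutual
  shiftV : ℕ → Val → Val
  shiftV c (var x) = if x <ᵇ c then var x else var (suc x)
  shiftV c (lam t) = lam (shiftT (suc c) t)

  shiftT : ℕ → Tm → Tm
  shiftT c (val v)   = val (shiftV c v)
  shiftT c (app t v) = app (shiftT c t) (shiftV c v)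

mutual
  substV : ℕ → Val → Val → Val
  substV j u (var x) = if x <ᵇ j then var x else (if x ≡ᵇ j then u else var (pred x))
  substV j u (lam t) = lam (substT (suc j) (shiftV 0 u) t)

  substT : ℕ → Val → Tm → Tm
  substT j u (val v)   = val (substV j u v)
  substT j u (app t v) = app (substT j u t) (substV j u v)

-- t{x:=u} where x is the variable bound by the outer λ
_[_] : Tm → Val → Tm
t [ u ] = substT 0 u t

infix 4 _⟶_
data _⟶_ : Tm → Tm → Set where
  β   : ∀ {t u} → app (val (lam t)) u ⟶ t [ u ]
  ctx : ∀ {t t' v} → t ⟶ t' → app t v ⟶ app t' v

data _⟶⟨_⟩_ : Tm → ℕ → Tm → Set where
  done : ∀ {t} → t ⟶⟨ 0 ⟩ t
  step : ∀ {t t' t'' n} → t ⟶ t' → t' ⟶⟨ n ⟩ t'' → t ⟶⟨ suc n ⟩ t''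

Λ : ℕ → Tm → Val
Λ zero    t = lam t
Λ (suc n) t = lam (val (Λ n t))

-- ⌈a_j⌉ = λx_1...λx_m. x_j   (alphabet Fin m, a_j ↦ the (j-1)-th element)
⌈_⌉c : ∀ {m} → Fin m → Val
⌈_⌉c {suc m} j = Λ m (val (var (m ∸ toℕ j)))

-- Scott-encoded strings: λx_1...λx_m.λx_ε. ...
⌈_⌉s : ∀ {m} → List (Fin m) → Val
⌈_⌉s {m} []      = Λ m (val (var 0))
⌈_⌉s {m} (a ∷ r) = Λ m (app (val (var (m ∸ toℕ a))) ⌈ r ⌉s)

data 𝔹I : Set where
  i0 i1 iL iR : 𝔹I

data 𝔹W : Set where
  w0 w1 w□ : 𝔹W

idxI : 𝔹I → Fin 4
idxI i0 = Fin.zero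
idxI i1 = Fin.suc Fin.zero
idxI iL = Fin.suc (Fin.suc Fin.zero)
idxI iR = Fin.suc (Fin.suc (Fin.suc Fin.zero))

idxW : 𝔹W → Fin 3
idxW w0 = Fin.zero
idxW w1 = Fin.suc Fin.zero
idxW w□ = Fin.suc (Fin.suc Fin.zero)

-- bin(n): reversed binary representation without trailing zeros, over {0,1} = Fin 2
binAux : ℕ → ℕ → List (Fin 2)
binAux zero    m       = []
binAux (suc f) zero    = []
binAux (suc f) (suc m) = fromℕ< (m%n<n (suc m) 2) ∷ binAux f (suc m / 2)

bin : ℕ → List (Fin 2)
bin n = binAux n n

data Shift : Set where
  -1ₛ +1ₛ 0ₛ : Shift

data Dir : Set where
  left right stay : Dir

record TM (q : ℕ) : Set where
  field
    s-in s-T s-F : Fin q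
    T≢F          : s-T ≢ s-F
    δ            : 𝔹I → 𝔹W → Fin q → Maybe (Shift × 𝔹W × Dir × Fin q)
    δ-T          : ∀ i a → δ i a s-T ≡ nothing
    δ-F          : ∀ i a → δ i a s-F ≡ nothing

record Config (q : ℕ) : Set where
  constructor ⟨_,_∣_,_,_∣_⟩
  field
    inp   : List 𝔹I
    idx   : ℕ
    wl    : List 𝔹W
    cur   : 𝔹W
    wr    : List 𝔹W
    state : Fin q

open Config public

⌈_⌉C : ∀ {q} → Config q → Val
⌈ C ⌉C = lam
  (app (app (app (app (app (app (val (var 0))
    ⌈ Data.List.map idxI (inp C) ⌉s)
    ⌈ bin (idx C) ⌉s)
    ⌈ Data.List.map idxW (reverse (wl C)) ⌉s)
    ⌈ idxW (cur C) ⌉c)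
    ⌈ Data.List.map idxW (wr C) ⌉s)
    ⌈ state C ⌉c)

trueV falseV : Val
trueV  = lam (val (lam (val (var 1))))
falseV = lam (val (lam (val (var 0))))

ΘSteps : ℕ → ℕ → ℕ → ℕ → Set
ΘSteps c₁ c₂ q n = (q ≤ c₁ * n) × (n ≤ c₂ * q)

-- Take final = λk.λc. c F k with F = λx₁…x₅.λy. y R₁ … R_q, where R_i = λk. k b_i and b_i is
-- the Church boolean of i = s_T. F discards the five tape fields of ⌈C⌉ and applies the state
-- encoding ⌈s⌉ = λy₁…y_q. y_s to the reports, which selects R_s. Unfolding final and ⌈C⌉ takes
-- 3 β-steps, discarding the fields 6, the selection q, and R_s k → k b_s one more: 10 + q steps
-- whatever the configuration, which is Θ(q) since q ≥ 1.
module Submission where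

open import Defs
open import Data.Nat using (ℕ; zero; suc; _+_; _*_; _<ᵇ_; _≡ᵇ_; _≤_; _<_; z≤n; s≤s; NonZero)
open import Data.Nat.Properties
  using (<⇒<ᵇ; ≤-trans; m∸n≤m; m≤n+m; m≤m*n; +-comm; +-suc; +-monoʳ-≤; *-identityˡ)
open import Data.Bool using (true; false; if_then_else_)
open import Data.Bool.Properties using (T-≡)
open import Data.Fin using (Fin; toℕ; _≟_)
open import Data.Fin.Properties using (nonZeroIndex)
open import Data.List using (List; []; _∷_; _++_; foldl; length; tabulate)
open import Data.List.Relation.Unary.All using (All; []; _∷_)
open import Data.List.Relation.Unary.All.Properties using (tabulate⁺; ++⁺)
open import Data.Product using (Σ; _×_; _,_)
open import Function using (_∘_; Equivalence)
open import Relation.Nullary using (does)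
open import Relation.Nullary.Decidable using (dec-true; dec-false)
open import Relation.Binary.PropositionalEquality
  using (_≡_; _≢_; refl; sym; trans; cong; cong₂; subst)

<ᵇ-true : ∀ {x c} → x < c → (x <ᵇ c) ≡ true
<ᵇ-true x<c = Equivalence.to T-≡ (<⇒<ᵇ x<c)

n<ᵇn : ∀ n → (n <ᵇ n) ≡ false
n<ᵇn zero    = refl
n<ᵇn (suc n) = n<ᵇn n

n≡ᵇn : ∀ n → (n ≡ᵇ n) ≡ true
n≡ᵇn zero    = refl
n≡ᵇn (suc n) = n≡ᵇn n

≮ᵇ⇒suc≮ᵇ : ∀ x c → (x <ᵇ c) ≡ false → (suc x <ᵇ c) ≡ false
≮ᵇ⇒suc≮ᵇ x       zero    _  = refl
≮ᵇ⇒suc≮ᵇ (suc x) (suc c) eq = ≮ᵇ⇒suc≮ᵇ x c eq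

≮ᵇ⇒suc≢ᵇ : ∀ x c → (x <ᵇ c) ≡ false → (suc x ≡ᵇ c) ≡ false
≮ᵇ⇒suc≢ᵇ x       zero    _  = refl
≮ᵇ⇒suc≢ᵇ (suc x) (suc c) eq = ≮ᵇ⇒suc≢ᵇ x c eq

mutual
  data ScopedV (d : ℕ) : Val → Set where
    var : ∀ {x} → x < d → ScopedV d (var x)
    lam : ∀ {t} → ScopedT (suc d) t → ScopedV d (lam t)

  data ScopedT (d : ℕ) : Tm → Set where
    val : ∀ {v} → ScopedV d v → ScopedT d (val v)
    app : ∀ {t v} → ScopedT d t → ScopedV d v → ScopedT d (app t v)

Closed : Val → Set
Closed = ScopedV 0

mutual
  scopedV-mono : ∀ {d e v} → d ≤ e → ScopedV d v → ScopedV e v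
  scopedV-mono d≤e (var x<d) = var (≤-trans x<d d≤e)
  scopedV-mono d≤e (lam sc)  = lam (scopedT-mono (s≤s d≤e) sc)

  scopedT-mono : ∀ {d e t} → d ≤ e → ScopedT d t → ScopedT e t
  scopedT-mono d≤e (val sc)      = val (scopedV-mono d≤e sc)
  scopedT-mono d≤e (app sct scv) = app (scopedT-mono d≤e sct) (scopedV-mono d≤e scv)

closed⇒scoped : ∀ {d v} → Closed v → ScopedV d v
closed⇒scoped = scopedV-mono z≤n

mutual
  substV-scoped : ∀ {j u v} → ScopedV j v → substV j u v ≡ v
  substV-scoped (var x<j) rewrite <ᵇ-true x<j = refl
  substV-scoped (lam sc)  = cong lam (substT-scoped sc)

  substT-scoped : ∀ {j u t} → ScopedT j t → substT j u t ≡ t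
  substT-scoped (val sc)      = cong val (substV-scoped sc)
  substT-scoped (app sct scv) = cong₂ app (substT-scoped sct) (substV-scoped scv)

mutual
  shiftV-scoped : ∀ {j v} → ScopedV j v → shiftV j v ≡ v
  shiftV-scoped (var x<j) rewrite <ᵇ-true x<j = refl
  shiftV-scoped (lam sc)  = cong lam (shiftT-scoped sc)

  shiftT-scoped : ∀ {j t} → ScopedT j t → shiftT j t ≡ t
  shiftT-scoped (val sc)      = cong val (shiftV-scoped sc)
  shiftT-scoped (app sct scv) = cong₂ app (shiftT-scoped sct) (shiftV-scoped scv)

substV-closed : ∀ {j u v} → Closed v → substV j u v ≡ v
substV-closed c = substV-scoped (closed⇒scoped c)

mutual
  substV-shiftV : ∀ c u v → substV c u (shiftV c v) ≡ v
  substV-shiftV c u (var x) with x <ᵇ c in eq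
  ... | true  rewrite eq = refl
  ... | false rewrite ≮ᵇ⇒suc≮ᵇ x c eq | ≮ᵇ⇒suc≢ᵇ x c eq = refl
  substV-shiftV c u (lam t) = cong lam (substT-shiftT (suc c) (shiftV 0 u) t)

  substT-shiftT : ∀ c u t → substT c u (shiftT c t) ≡ t
  substT-shiftT c u (val v)   = cong val (substV-shiftV c u v)
  substT-shiftT c u (app t v) = cong₂ app (substT-shiftT c u t) (substV-shiftV c u v)

substV-var : ∀ j u → substV j u (var j) ≡ u
substV-var j u rewrite n<ᵇn j | n≡ᵇn j = refl

-- Bounds are written d + suc m so that they reduce to suc m at the closed level d = 0.
Λ-scoped : ∀ m d {t} → ScopedT (d + suc m) t → ScopedV d (Λ m t)
Λ-scoped zero    d {t} sc = lam (subst (λ e → ScopedT e t) (+-comm d 1) sc)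
Λ-scoped (suc m) d {t} sc = lam (val (Λ-scoped m (suc d) (subst (λ e → ScopedT e t) (+-suc d (suc m)) sc)))

substV-Λ : ∀ n j t u → Closed u → substV j u (Λ n t) ≡ Λ n (substT (j + suc n) u t)
substV-Λ zero    j t u c rewrite shiftV-scoped c | +-comm j 1 = refl
substV-Λ (suc n) j t u c rewrite shiftV-scoped c | substV-Λ n (suc j) t u c | +-suc j (suc n) = refl

⌈⌉c-closed : ∀ {m} (j : Fin m) → Closed ⌈ j ⌉c
⌈⌉c-closed {suc m} j = Λ-scoped m 0 (val (var (s≤s (m∸n≤m m (toℕ j)))))

⌈⌉s-closed : ∀ {m} (r : List (Fin m)) → Closed ⌈ r ⌉s
⌈⌉s-closed {m} []      = Λ-scoped m 0 (val (var (s≤s z≤n)))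
⌈⌉s-closed {m} (a ∷ r) = Λ-scoped m 0 (app (val (var (s≤s (m∸n≤m m (toℕ a))))) (closed⇒scoped (⌈⌉s-closed r)))

infixr 5 _◅◅_
_◅◅_ : ∀ {t t' t'' a b} → t ⟶⟨ a ⟩ t' → t' ⟶⟨ b ⟩ t'' → t ⟶⟨ a + b ⟩ t''
done     ◅◅ r' = r'
step s r ◅◅ r' = step s (r ◅◅ r')

infixl 6 _▻_
_▻_ : ∀ {t t' t'' n} → t ⟶⟨ n ⟩ t' → t' ⟶ t'' → t ⟶⟨ suc n ⟩ t''
done     ▻ s' = step s' done
step s r ▻ s' = step s (r ▻ s')

β≡ : ∀ {t u t'} → t [ u ] ≡ t' → app (val (lam t)) u ⟶ t'
β≡ refl = β

apps : Tm → List Val → Tm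
apps = foldl app

apps-ctx : ∀ vs {t t'} → t ⟶ t' → apps t vs ⟶ apps t' vs
apps-ctx []       s = s
apps-ctx (v ∷ vs) s = apps-ctx vs (ctx s)

apps-ctx* : ∀ vs {t t' n} → t ⟶⟨ n ⟩ t' → apps t vs ⟶⟨ n ⟩ apps t' vs
apps-ctx* vs done       = done
apps-ctx* vs (step s r) = step (apps-ctx vs s) (apps-ctx* vs r)

apps-scoped : ∀ {d t vs} → ScopedT d t → All Closed vs → ScopedT d (apps t vs)
apps-scoped sc []       = sc
apps-scoped sc (c ∷ cs) = apps-scoped (app sc (closed⇒scoped c)) cs

substT-apps : ∀ {j u t vs} → All Closed vs → substT j u (apps t vs) ≡ apps (substT j u t) vs
substT-apps []                   = refl
substT-apps {j} {u} {t} {v ∷ vs} (c ∷ cs) =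
  trans (substT-apps cs) (cong (λ v' → apps (app (substT j u t) v') vs) (substV-closed c))

Λ-β-vacuous : ∀ {n t u} → Closed u → ScopedT (suc n) t → app (val (Λ (suc n) t)) u ⟶ val (Λ n t)
Λ-β-vacuous {n} {t} {u} c sc = β≡ (cong val (trans (substV-Λ n 0 t u c) (cong (Λ n) (substT-scoped sc))))

Λ-const : ∀ m {v} (f : Fin (suc m) → Val) → Closed v → (∀ i → Closed (f i)) →
  apps (val (Λ m (val v))) (tabulate f) ⟶⟨ suc m ⟩ val v
Λ-const zero    f cv cf = step (β≡ (cong val (substV-closed cv))) done
Λ-const (suc m) f cv cf =
  step (apps-ctx (tabulate (f ∘ Fin.suc)) (Λ-β-vacuous (cf Fin.zero) (val (closed⇒scoped cv))))
       (Λ-const m (f ∘ Fin.suc) cv (cf ∘ Fin.suc))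

Λ-drop : ∀ us {u} vs {t} → All Closed us → ScopedT 1 t →
  apps (val (Λ (length us) t)) (us ++ u ∷ vs) ⟶⟨ suc (length us) ⟩ apps (t [ u ]) vs
Λ-drop []       vs cs       sc = step (apps-ctx vs β) done
Λ-drop (_ ∷ us) vs (c ∷ cs) sc =
  step (apps-ctx (us ++ _ ∷ vs) (Λ-β-vacuous c (scopedT-mono (s≤s z≤n) sc))) (Λ-drop us vs cs sc)

⌈⌉c-select : ∀ {m} (j : Fin (suc m)) (f : Fin (suc m) → Val) → (∀ i → Closed (f i)) →
  apps (val ⌈ j ⌉c) (tabulate f) ⟶⟨ suc m ⟩ val (f j)
⌈⌉c-select {zero}  Fin.zero    f cf = step β done
⌈⌉c-select {suc m} Fin.zero    f cf =
  step (apps-ctx (tabulate (f ∘ Fin.suc))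
         (β≡ (cong val (trans (substV-Λ m 0 _ _ (cf Fin.zero))
                              (cong (Λ m ∘ val) (substV-var (suc m) (f Fin.zero)))))))
       (Λ-const m (f ∘ Fin.suc) (cf Fin.zero) (cf ∘ Fin.suc))
⌈⌉c-select {suc m} (Fin.suc j) f cf =
  step (apps-ctx (tabulate (f ∘ Fin.suc)) (Λ-β-vacuous (cf Fin.zero) (val (var (s≤s (m∸n≤m m (toℕ j)))))))
       (⌈⌉c-select j (f ∘ Fin.suc) (cf ∘ Fin.suc))

tapeFields : ∀ {q} → Config q → List Val
tapeFields C =
  ⌈ Data.List.map idxI (inp C) ⌉s ∷ ⌈ bin (idx C) ⌉s ∷ ⌈ Data.List.map idxW (Data.List.reverse (wl C)) ⌉s ∷
  ⌈ idxW (cur C) ⌉c ∷ ⌈ Data.List.map idxW (wr C) ⌉s ∷ []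

tapeFields-closed : ∀ {q} (C : Config q) → All Closed (tapeFields C)
tapeFields-closed C =
  ⌈⌉s-closed (Data.List.map idxI (inp C)) ∷ ⌈⌉s-closed (bin (idx C)) ∷
  ⌈⌉s-closed (Data.List.map idxW (Data.List.reverse (wl C))) ∷ ⌈⌉c-closed (idxW (cur C)) ∷
  ⌈⌉s-closed (Data.List.map idxW (wr C)) ∷ []

⌈⌉C-β : ∀ {q} (C : Config q) u → app (val ⌈ C ⌉C) u ⟶ apps (val u) (tapeFields C ++ ⌈ state C ⌉c ∷ [])
⌈⌉C-β C u = β≡ (substT-apps {t = val (var 0)} (++⁺ (tapeFields-closed C) (⌈⌉c-closed (state C) ∷ [])))

answer : ∀ {q} → Fin q → Fin q → Val
answer sT s = if does (s ≟ sT) then trueV else falseV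

report : ∀ {q} → Fin q → Fin q → Val
report sT s = lam (app (val (var 0)) (answer sT s))

caseState : ∀ {q} → Fin q → Tm
caseState sT = apps (val (var 0)) (tabulate (report sT))

onConfig : ∀ {q} → Fin q → Val
onConfig sT = Λ 5 (caseState sT)

callWith : Val → Val
callWith f = lam (val (lam (app (app (val (var 0)) f) (var 1))))

final : ∀ {q} → Fin q → Tm
final sT = val (callWith (onConfig sT))

answer-closed : ∀ {q} (sT s : Fin q) → Closed (answer sT s)
answer-closed sT s with does (s ≟ sT)
... | true  = lam (val (lam (val (var (s≤s (s≤s z≤n))))))
... | false = lam (val (lam (val (var (s≤s z≤n)))))

answer-accept : ∀ {q} {sT s : Fin q} → s ≡ sT → answer sT s ≡ trueV
answer-accept {sT = sT} {s} s≡sT rewrite dec-true (s ≟ sT) s≡sT = refl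

answer-reject : ∀ {q} {sT s : Fin q} → s ≢ sT → answer sT s ≡ falseV
answer-reject {sT = sT} {s} s≢sT rewrite dec-false (s ≟ sT) s≢sT = refl

report-closed : ∀ {q} (sT s : Fin q) → Closed (report sT s)
report-closed sT s = lam (app (val (var (s≤s z≤n))) (closed⇒scoped (answer-closed sT s)))

reports-closed : ∀ {q} (sT : Fin q) → All Closed (tabulate (report sT))
reports-closed sT = tabulate⁺ (report-closed sT)

caseState-scoped : ∀ {q d} (sT : Fin q) → ScopedT (suc d) (caseState sT)
caseState-scoped sT = apps-scoped (val (var (s≤s z≤n))) (reports-closed sT)

onConfig-closed : ∀ {q} (sT : Fin q) → Closed (onConfig sT)
onConfig-closed sT = Λ-scoped 5 0 (caseState-scoped sT)

report-β : ∀ {q} (sT s : Fin q) k → app (val (report sT s)) k ⟶ app (val k) (answer sT s)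
report-β sT s k = β≡ (cong (app (val k)) (substV-closed (answer-closed sT s)))

callWith-β : ∀ {f} k c → Closed f → app (app (val (callWith f)) k) c ⟶⟨ 2 ⟩ app (app (val c) f) k
callWith-β {f} k c cf =
  step (ctx (β≡ (cong (λ f' → val (lam (app (app (val (var 0)) f') (shiftV 0 k)))) (substV-closed cf))))
  (step (β≡ (cong₂ (λ f' k' → app (app (val c) f') k') (substV-closed cf) (substV-shiftV 0 c k))) done)

onConfig-β : ∀ {q} (sT : Fin q) (C : Config q) k →
  app (apps (val (onConfig sT)) (tapeFields C ++ ⌈ state C ⌉c ∷ [])) k
    ⟶⟨ 6 ⟩ app (apps (val ⌈ state C ⌉c) (tabulate (report sT))) k
onConfig-β sT C k =
  subst (λ t → app (apps (val (onConfig sT)) (tapeFields C ++ ⌈ state C ⌉c ∷ [])) k ⟶⟨ 6 ⟩ app t k)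
    (substT-apps (reports-closed sT))
    (Λ-drop (tapeFields C) (k ∷ []) (tapeFields-closed C) (caseState-scoped sT))

final-correct : ∀ {q} (sT : Fin q) k (C : Config q) →
  app (app (final sT) k) ⌈ C ⌉C ⟶⟨ 10 + q ⟩ app (val k) (answer sT (state C))
final-correct {suc _} sT k C =
  callWith-β k ⌈ C ⌉C (onConfig-closed sT)
  ◅◅ step (ctx (⌈⌉C-β C (onConfig sT)))
       (onConfig-β sT C k
        ◅◅ apps-ctx* (k ∷ []) (⌈⌉c-select (state C) (report sT) (report-closed sT))
        ▻ report-β sT (state C) k)

steps-Θ : ∀ q .{{_ : NonZero q}} → ΘSteps 1 11 q (10 + q)
steps-Θ q = subst (q ≤_) (sym (*-identityˡ (10 + q))) (m≤n+m q 10)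
          , subst (_≤ 11 * q) (+-comm q 10) (+-monoʳ-≤ q (m≤m*n 10 q))

final-decides : ∀ {q} (sT : Fin q) k (C : Config q) {b} → answer sT (state C) ≡ b →
  Σ ℕ λ n → (app (app (final sT) k) ⌈ C ⌉C ⟶⟨ n ⟩ app (val k) b) × ΘSteps 1 11 q n
final-decides {q} sT k C answer≡b =
  10 + q , subst (λ b → _ ⟶⟨ 10 + q ⟩ app (val k) b) answer≡b (final-correct sT k C)
         , steps-Θ q {{nonZeroIndex sT}}

mainTheorem7 : Σ ℕ λ c₁ → Σ ℕ λ c₂ →
    (q : ℕ) (M : TM q) → Σ Tm λ final →
      (k : Val) (C : Config q) →
        (state C ≡ TM.s-T M →
          Σ ℕ λ n → (app (app final k) ⌈ C ⌉C ⟶⟨ n ⟩ app (val k) trueV) × ΘSteps c₁ c₂ q n)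
        × (state C ≡ TM.s-F M →
          Σ ℕ λ n → (app (app final k) ⌈ C ⌉C ⟶⟨ n ⟩ app (val k) falseV) × ΘSteps c₁ c₂ q n)
mainTheorem7 = 1 , 11 , λ q M → let open TM M in
  final s-T , λ k C →
      (λ s≡T → final-decides s-T k C (answer-accept s≡T))
    , (λ s≡F → final-decides s-T k C (answer-reject (λ s≡T → T≢F (trans (sym s≡T) s≡F))))
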